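{- Fix an integer $r\geq3$. Let $A,B,C$ be nonempty subsets of $[r]$ with $|A|\geq|B|\geq|C|$, $|A|>m(r)$ and $|B|\geq m(r)$. Put $x=|A|-m(r)$ and $y=|B|-m(r)$, and suppose $|C|\geq\max\{m(r)-x-y,1\}$ if $r$ is even, and $|C|\geq\max\{m(r)-x-y+2,1\}$ if $r$ is odd. Then there is a violating triple $(a,b,c)\in A\times B\times C$.
   Context: $[r]=\{1,\ldots,r\}$ and $m(r)=\lceil\frac{r+1}{2}\rceil$. A violating triple is a tuple $(i,j,k)\in\mathbb N^3$ for which $|i-j|\leq k\leq i+j$ fails. -}

module Defs where

open import Data.Nat using (ℕ; suc; _+_; _∸_; _≤_; _⊔_; ⌈_/2⌉; ∣_-_∣; _%_)
open import Data.Fin using (Fin; toℕ)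
open import Data.Fin.Subset using (Subset; _∈_)
open import Data.Product using (∃; _×_; _,_)
open import Relation.Binary.PropositionalEquality using (_≡_)
open import Relation.Nullary using (¬_)

m : ℕ → ℕ
m r = ⌈ suc r /2⌉

Violating : ℕ → ℕ → ℕ → Set
Violating i j k = ¬ (∣ i - j ∣ ≤ k × k ≤ i + j)

-- element f : Fin r of a subset of Fin r represents the integer toℕ f + 1 ∈ [r]
val : ∀ {r} → Fin r → ℕ
val f = suc (toℕ f)

-- lower bound on |C|: max{m-x-y,1} (r even), max{m-x-y+2,1} (r odd).
-- Truncated subtraction is harmless because of the max with 1.
cBound : (r x y : ℕ) → ℕ
cBound r x y with r % 2
... | 0 = (m r ∸ (x + y)) ⊔ 1
... | _ = ((m r + 2) ∸ (x + y)) ⊔ 1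

HasViolatingTriple : ∀ {r} → Subset r → Subset r → Subset r → Set
HasViolatingTriple A B C =
  ∃ λ a → ∃ λ b → ∃ λ c → a ∈ A × b ∈ B × c ∈ C × Violating (val a) (val b) (val c)

-- Suppose no triple of A × B × C is violating, and let α, β, γ be the least elements of A, B, C.
-- Then A ⊆ [α, r]; every b ∈ B satisfies b ≤ α + γ (triangle inequality for (α, b, γ)); every
-- c ∈ C satisfies c ≤ α + β (for (α, β, c)). Hence |A| ≤ r + 1 − α, |B| ≤ α + γ + 1 − β and
-- |C| ≤ α + β + 1 − γ, and adding the first bound twice to the other two eliminates α, β, γ:
-- 2|A| + |B| + |C| ≤ 2r + 4. Writing |A| = m + x, |B| = m + y with x ≥ 1, the bound on |C|
-- gives 2|A| + |B| + |C| ≥ 3m + N + x, where 2r + 4 = 3m + N (N = m for r even, m + 2 for r odd).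
module Submission where

open import Defs
open import Data.Nat using (ℕ; zero; suc; _+_; _∸_; _⊔_; _≤_; _<_; z≤n; s≤s; ∣_-_∣; _%_; _≤?_)
open import Data.Nat.Properties
open import Data.Nat.DivMod using ([m+n]%n≡m%n)
open import Data.Nat.Tactic.RingSolver using (solve-∀)
open import Data.Bool using (true; false)
open import Data.Vec using ([]; _∷_)
open import Data.Fin using (Fin; toℕ) renaming (zero to fzero; suc to fsuc)
open import Data.Fin.Properties using (any?; toℕ<n)
open import Data.Fin.Subset using (Subset; ∣_∣; Nonempty; _∈_)
open import Data.Fin.Subset.Properties using (_∈?_)
open import Data.Vec.Base using (here; there)
open import Data.Product using (∃; _×_; _,_; proj₁; proj₂) renaming (map to map-×)
open import Data.Sum using (_⊎_; inj₁; inj₂) renaming (map to map-⊎)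
open import Relation.Nullary using (¬_; Dec; yes; no; contradiction)
open import Relation.Nullary.Decidable using (_×-dec_; ¬?; decidable-stable)
open import Relation.Binary.PropositionalEquality
  using (_≡_; refl; sym; trans; cong; cong₂; subst; subst₂)

shift-∈ : ∀ {n x k} {p : Subset n} (P : ℕ → Set) →
  (∀ {f} → f ∈ x ∷ p → P (k + toℕ f)) → ∀ {f} → f ∈ p → P (suc k + toℕ f)
shift-∈ {k = k} P h {f} f∈p = subst P (+-suc k (toℕ f)) (h (there f∈p))

∣p∣+lo≤suc-hi : ∀ {n} (p : Subset n) k {lo hi} → lo ≤ suc hi →
  (∀ {f} → f ∈ p → lo ≤ k + toℕ f) → (∀ {f} → f ∈ p → k + toℕ f ≤ hi) →
  ∣ p ∣ + lo ≤ suc hi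
∣p∣+lo≤suc-hi [] k lo≤ _ _ = lo≤
∣p∣+lo≤suc-hi (false ∷ p) k {lo} {hi} lo≤ lower upper =
  ∣p∣+lo≤suc-hi p (suc k) lo≤ (shift-∈ (lo ≤_) lower) (shift-∈ (_≤ hi) upper)
∣p∣+lo≤suc-hi (true ∷ p) k {lo} {hi} _ lower upper = begin
  suc ∣ p ∣ + lo   ≡⟨ sym (+-suc ∣ p ∣ lo) ⟩
  ∣ p ∣ + suc lo   ≤⟨ +-monoʳ-≤ ∣ p ∣ (s≤s lo≤k) ⟩
  ∣ p ∣ + suc k    ≤⟨ ∣p∣+lo≤suc-hi p (suc k) (s≤s k≤hi) (λ {f} _ → m≤m+n (suc k) (toℕ f)) (shift-∈ (_≤ hi) upper) ⟩
  suc hi           ∎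
  where
  open ≤-Reasoning
  lo≤k : lo ≤ k
  lo≤k = subst (lo ≤_) (+-identityʳ k) (lower here)
  k≤hi : k ≤ hi
  k≤hi = subst (_≤ hi) (+-identityʳ k) (upper here)

record Least {n} (p : Subset n) : Set where
  field
    min  : Fin n
    min∈ : min ∈ p
    min≤ : ∀ {f} → f ∈ p → toℕ min ≤ toℕ f

least : ∀ {n} {p : Subset n} → Nonempty p → Least p
least {p = true ∷ p} _ = record { min = fzero ; min∈ = here ; min≤ = λ _ → z≤n }
least {p = false ∷ p} (fsuc f , there f∈p) = record
  { min  = fsuc min
  ; min∈ = there min∈
  ; min≤ = λ { (there g∈p) → s≤s (min≤ g∈p) }
  }
  where open Least (least (f , f∈p))

∣p∣+min≤suc-bound : ∀ {n} {p : Subset n} (μ : Least p) {hi} →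
  (∀ {f} → f ∈ p → val f ≤ hi) → ∣ p ∣ + val (Least.min μ) ≤ suc hi
∣p∣+min≤suc-bound {p = p} μ upper =
  ∣p∣+lo≤suc-hi p 1 (m≤n⇒m≤1+n (upper min∈)) (λ f∈p → s≤s (min≤ f∈p)) upper
  where open Least μ

Triangle : ℕ → ℕ → ℕ → Set
Triangle i j k = ∣ i - j ∣ ≤ k × k ≤ i + j

triangle? : ∀ i j k → Dec (Triangle i j k)
triangle? i j k = (∣ i - j ∣ ≤? k) ×-dec (k ≤? i + j)

hasViolatingTriple? : ∀ {r} (A B C : Subset r) → Dec (HasViolatingTriple A B C)
hasViolatingTriple? A B C = any? λ a → any? λ b → any? λ c →
  (a ∈? A) ×-dec (b ∈? B) ×-dec (c ∈? C) ×-dec ¬? (triangle? (val a) (val b) (val c))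

interval-bounds-sum : ∀ r p q s α β γ → p + α ≤ suc r → q + β ≤ suc (α + γ) →
  s + γ ≤ suc (α + β) → p + p + q + s ≤ 4 + (r + r)
interval-bounds-sum r p q s α β γ hp hq hs =
  +-cancelʳ-≤ (α + α + β + γ) (p + p + q + s) (4 + (r + r))
    (subst₂ _≤_ (lhs p q s α β γ) (rhs r α β γ) (+-mono-≤ (+-mono-≤ (+-mono-≤ hp hp) hq) hs))
  where
  lhs : ∀ p q s α β γ →
    (p + α) + (p + α) + (q + β) + (s + γ) ≡ (p + p + q + s) + (α + α + β + γ)
  lhs = solve-∀
  rhs : ∀ r α β γ →
    suc r + suc r + suc (α + γ) + suc (α + β) ≡ (4 + (r + r)) + (α + α + β + γ)
  rhs = solve-∀

module _ {r} {A B C : Subset r} (noViolation : ¬ HasViolatingTriple A B C) where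

  triangle : ∀ {a b c} → a ∈ A → b ∈ B → c ∈ C → Triangle (val a) (val b) (val c)
  triangle {a} {b} {c} a∈A b∈B c∈C = decidable-stable (triangle? (val a) (val b) (val c))
    (λ violating → noViolation (a , b , c , a∈A , b∈B , c∈C , violating))

  2∣A∣+∣B∣+∣C∣≤2r+4 : Nonempty A → Nonempty B → Nonempty C → ∣ A ∣ + ∣ A ∣ + ∣ B ∣ + ∣ C ∣ ≤ 4 + (r + r)
  2∣A∣+∣B∣+∣C∣≤2r+4 neA neB neC = interval-bounds-sum r (∣ A ∣) (∣ B ∣) (∣ C ∣) (val α) (val β) (val γ)
    (∣p∣+min≤suc-bound μA (λ {a} _ → toℕ<n a))
    (∣p∣+min≤suc-bound μB (λ {b} b∈B →
      ≤-trans (m≤n+∣n-m∣ (val b) (val α)) (+-monoʳ-≤ (val α) (proj₁ (triangle α∈A b∈B γ∈C)))))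
    (∣p∣+min≤suc-bound μC (λ c∈C → proj₂ (triangle α∈A β∈B c∈C)))
    where
    μA = least neA
    μB = least neB
    μC = least neC
    open Least μA renaming (min to α; min∈ to α∈A)
    open Least μB renaming (min to β; min∈ to β∈B)
    open Least μC renaming (min to γ; min∈ to γ∈C)

m-parity : ∀ r → (r % 2 ≡ 0 × suc (suc r) ≡ m r + m r) ⊎ (r % 2 ≡ 1 × suc r ≡ m r + m r)
m-parity zero = inj₁ (refl , refl)
m-parity (suc zero) = inj₂ (refl , refl)
m-parity (suc (suc r)) = map-⊎ (map-× (trans %2-step) step) (map-× (trans %2-step) step) (m-parity r)
  where
  %2-step : suc (suc r) % 2 ≡ r % 2
  %2-step = trans (cong (_% 2) (+-comm 2 r)) ([m+n]%n≡m%n r 2)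
  step : ∀ {n} → n ≡ m r + m r → suc (suc n) ≡ m (suc (suc r)) + m (suc (suc r))
  step eq = cong suc (trans (cong suc eq) (sym (+-suc (m r) (m r))))

cBound-shape : ∀ r → ∃ λ N →
  4 + (r + r) ≡ m r + m r + m r + N × (∀ x y → cBound r x y ≡ (N ∸ (x + y)) ⊔ 1)
cBound-shape r with m-parity r
... | inj₁ (even , eq) = m r , trans (split r) (trans (cong₂ _+_ eq eq) (regroup (m r))) , cBound≡
  where
  split : ∀ r → 4 + (r + r) ≡ suc (suc r) + suc (suc r)
  split = solve-∀
  regroup : ∀ M → (M + M) + (M + M) ≡ M + M + M + M
  regroup = solve-∀
  cBound≡ : ∀ x y → cBound r x y ≡ (m r ∸ (x + y)) ⊔ 1
  cBound≡ x y rewrite even = refl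
... | inj₂ (odd , eq) = m r + 2 , trans (split r) (trans (cong (λ n → n + n + 2) eq) (regroup (m r))) , cBound≡
  where
  split : ∀ r → 4 + (r + r) ≡ suc r + suc r + 2
  split = solve-∀
  regroup : ∀ M → (M + M) + (M + M) + 2 ≡ M + M + M + (M + 2)
  regroup = solve-∀
  cBound≡ : ∀ x y → cBound r x y ≡ ((m r + 2) ∸ (x + y)) ⊔ 1
  cBound≡ x y rewrite odd = refl

3M+N<2[M+x]+[M+y]+s : ∀ M N x y s → 1 ≤ x → N ≤ (x + y) + s →
  M + M + M + N < (M + x) + (M + x) + (M + y) + s
3M+N<2[M+x]+[M+y]+s M N x y s 1≤x N≤ = begin-strict
  M + M + M + N                  <⟨ +-monoˡ-≤ (M + M + M + N) 1≤x ⟩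
  x + (M + M + M + N)            ≤⟨ +-monoʳ-≤ x (+-monoʳ-≤ (M + M + M) N≤) ⟩
  x + (M + M + M + ((x + y) + s)) ≡⟨ regroup M x y s ⟩
  (M + x) + (M + x) + (M + y) + s ∎
  where
  open ≤-Reasoning
  regroup : ∀ M x y s → x + (M + M + M + ((x + y) + s)) ≡ (M + x) + (M + x) + (M + y) + s
  regroup = solve-∀

lemma4p9 : (r : ℕ) → 3 ≤ r → (A B C : Subset r) →
    Nonempty A → Nonempty B → Nonempty C →
    ∣ B ∣ ≤ ∣ A ∣ → ∣ C ∣ ≤ ∣ B ∣ → m r < ∣ A ∣ → m r ≤ ∣ B ∣ →
    cBound r (∣ A ∣ ∸ m r) (∣ B ∣ ∸ m r) ≤ ∣ C ∣ →
    HasViolatingTriple A B C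
lemma4p9 r _ A B C neA neB neC _ _ m<∣A∣ m≤∣B∣ cBound≤ with hasViolatingTriple? A B C | cBound-shape r
... | yes violation | _ = violation
... | no noViolation | N , 4+2r≡ , cBound≡ =
  contradiction (2∣A∣+∣B∣+∣C∣≤2r+4 noViolation neA neB neC) (<⇒≱ (begin-strict
    4 + (r + r)                         ≡⟨ 4+2r≡ ⟩
    M + M + M + N                       <⟨ 3M+N<2[M+x]+[M+y]+s M N x y ∣ C ∣ (m<n⇒0<n∸m m<∣A∣) N≤ ⟩
    (M + x) + (M + x) + (M + y) + ∣ C ∣ ≡⟨ cong₂ (λ p q → p + p + q + ∣ C ∣) M+x≡ M+y≡ ⟩
    ∣ A ∣ + ∣ A ∣ + ∣ B ∣ + ∣ C ∣       ∎))
  where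
  open ≤-Reasoning
  M = m r
  x = ∣ A ∣ ∸ M
  y = ∣ B ∣ ∸ M
  M+x≡ : M + x ≡ ∣ A ∣
  M+x≡ = m+[n∸m]≡n (<⇒≤ m<∣A∣)
  M+y≡ : M + y ≡ ∣ B ∣
  M+y≡ = m+[n∸m]≡n m≤∣B∣
  N≤ : N ≤ (x + y) + ∣ C ∣
  N≤ = ≤-trans (m≤n+m∸n N (x + y))
    (+-monoʳ-≤ (x + y) (≤-trans (m≤m⊔n _ 1) (subst (_≤ ∣ C ∣) (cBound≡ x y) cBound≤)))
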